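{- Let $n\ge 3$ and let $s,t$ be indeterminates. Let $\mathfrak{D}_n^2$ be the set of $\pi\in\mathfrak{D}_n$ such that $\pi''\in\mathfrak{D}_{n-2}$, both $n$ and $n-1$ appear (with positive sign) among $\pi_1,\dots,\pi_n$ in adjacent positions, and $\pi_n\notin\{n-1,n\}$. Let $\mathfrak{D}_n^3$ be the set of $\pi\in\mathfrak{D}_n$ such that $\pi''\in\mathfrak{D}_{n-2}$, both $-n$ and $-(n-1)$ appear among $\pi_1,\dots,\pi_n$ in adjacent positions, and $\pi_n\notin\{ -(n-1),-n\}$. Then $$\sum_{\pi\in\mathfrak{D}_n^2\cup\mathfrak{D}_n^3}(-1)^{\mathrm{inv}_D(\pi)}s^{\mathrm{asc}_B(\pi)}t^{\mathrm{des}_B(\pi)}=0.$$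
   Context: $\mathfrak{B}_n$ is the group of signed permutations of $\{\pm1,\dots,\pm n\}$, written $\pi=\pi_1\cdots\pi_n$ with $\pi_i=\pi(i)$. $\mathrm{negs}(\pi)=|\{i:\pi_i<0\}|$; $\mathfrak{D}_n=\{\pi\in\mathfrak{B}_n:\mathrm{negs}(\pi)\text{ even}\}$. $\mathrm{inv}_D(\pi)=|\{i<j:\pi_i>\pi_j\}|+|\{i<j:-\pi_i>\pi_j\}|$. With $\pi_0=0$, $\mathrm{des}_B(\pi)=|\{i\in\{0,\dots,n-1\}:\pi_i>\pi_{i+1}\}|$ and $\mathrm{asc}_B(\pi)=n-\mathrm{des}_B(\pi)$. For $\pi\in\mathfrak{B}_n$, $\pi''\in\mathfrak{B}_{n-2}$ is the signed word obtained from $\pi_1\cdots\pi_n$ by deleting the two entries whose absolute values are $n$ and $n-1$. -}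

module Defs where

open import Data.Bool using (Bool; true; false; _∧_; _∨_; not; if_then_else_)
open import Data.Nat as ℕ using (ℕ; zero; suc; _∸_)
open import Data.Integer as ℤ using (ℤ; +_; -_; ∣_∣; _<?_)
open import Data.List using (List; []; _∷_; length; map; filterᵇ; concatMap; applyUpTo; last; foldr)
open import Data.Maybe using (Maybe; just; nothing)
open import Relation.Nullary.Decidable using (does)
open import Algebra.Bundles using (CommutativeRing)
open import Level using (Level)

infix 4 _<ᵇ_ _==ᵇ_ _==ℕ_

allᵇ : {A : Set} → (A → Bool) → List A → Bool
allᵇ p [] = true
allᵇ p (x ∷ xs) = p x ∧ allᵇ p xs

_<ᵇ_ : ℤ → ℤ → Bool
x <ᵇ y = does (x <? y)

_==ᵇ_ : ℤ → ℤ → Bool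
x ==ᵇ y = does (x ℤ.≟ y)

_==ℕ_ : ℕ → ℕ → Bool
m ==ℕ k = does (m ℕ.≟ k)

countᵇ : {A : Set} → (A → Bool) → List A → ℕ
countᵇ p xs = length (filterᵇ p xs)

letters : ℕ → List ℤ
letters n = concatMap (λ i → + suc i ∷ - (+ suc i) ∷ []) (applyUpTo (λ i → i) n)

words : ℕ → ℕ → List (List ℤ)
words n zero = [] ∷ []
words n (suc k) = concatMap (λ x → map (x ∷_) (words n k)) (letters n)

distinctAbs : List ℤ → Bool
distinctAbs [] = true
distinctAbs (x ∷ xs) = allᵇ (λ y → not (∣ x ∣ ==ℕ ∣ y ∣)) xs ∧ distinctAbs xs

Bn : ℕ → List (List ℤ)
Bn n = filterᵇ distinctAbs (words n n)

negs : List ℤ → ℕ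
negs π = countᵇ (λ x → x <ᵇ + 0) π

even : ℕ → Bool
even zero = true
even (suc zero) = false
even (suc (suc k)) = even k

isD : List ℤ → Bool
isD π = even (negs π)

invD : List ℤ → ℕ
invD [] = 0
invD (x ∷ xs) = countᵇ (λ y → y <ᵇ x) xs ℕ.+ countᵇ (λ y → y <ᵇ (- x)) xs ℕ.+ invD xs

descents : List ℤ → ℕ
descents [] = 0
descents (x ∷ []) = 0
descents (x ∷ y ∷ ys) = (if y <ᵇ x then 1 else 0) ℕ.+ descents (y ∷ ys)

desB : List ℤ → ℕ
desB π = descents (+ 0 ∷ π)

ascB : ℕ → List ℤ → ℕ
ascB n π = n ∸ desB π

-- π'' : delete the entries of absolute value n and n-1
pp : ℕ → List ℤ → List ℤ
pp n π = filterᵇ (λ x → not (∣ x ∣ ==ℕ n) ∧ not (∣ x ∣ ==ℕ (n ∸ 1))) π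

adjacent : ℤ → ℤ → List ℤ → Bool
adjacent a b [] = false
adjacent a b (x ∷ []) = false
adjacent a b (x ∷ y ∷ ys) =
  ((x ==ᵇ a) ∧ (y ==ᵇ b)) ∨ ((x ==ᵇ b) ∧ (y ==ᵇ a)) ∨ adjacent a b (y ∷ ys)

lastNotIn : List ℤ → List ℤ → Bool
lastNotIn forbidden π with last π
... | nothing = true
... | just z = allᵇ (λ f → not (z ==ᵇ f)) forbidden

inD2 : ℕ → List ℤ → Bool
inD2 n π = isD π ∧ isD (pp n π) ∧ adjacent (+ n) (+ (n ∸ 1)) π
           ∧ lastNotIn (+ (n ∸ 1) ∷ + n ∷ []) π

inD3 : ℕ → List ℤ → Bool
inD3 n π = isD π ∧ isD (pp n π) ∧ adjacent (- (+ n)) (- (+ (n ∸ 1))) π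
           ∧ lastNotIn (- (+ (n ∸ 1)) ∷ - (+ n) ∷ []) π

D23 : ℕ → List (List ℤ)
D23 n = filterᵇ (λ π → inD2 n π ∨ inD3 n π) (Bn n)

module _ {c ℓ : Level} (R : CommutativeRing c ℓ) where
  open CommutativeRing R using (Carrier; _+_; _*_; 0#; 1#) renaming (-_ to neg)

  pow : Carrier → ℕ → Carrier
  pow x zero = 1#
  pow x (suc k) = x * pow x k

  D23sum : ℕ → Carrier → Carrier → Carrier
  D23sum n s t = foldr (λ π acc → (pow (neg 1#) (invD π) * pow s (ascB n π)) * pow t (desB π) + acc)
                       0# (D23 n)

-- Let σ exchange the letters n ↔ −(n−1) and n−1 ↔ −n and fix all other letters, acting letterwise
-- on words.  On words with distinct absolute values σ preserves π″, the adjacency of the two letters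
-- of absolute value n−1 and n, and the condition on the last entry, while it flips the signs of
-- exactly those two letters; so σ maps 𝔇ₙ² bijectively onto 𝔇ₙ³.  In π ∈ 𝔇ₙ² the block formed by
-- n and n−1 lies above every other entry and its image lies below every other entry, with the same
-- internal order.  Since an entry follows the block (πₙ ∉ {n−1, n}), the descent into the block and
-- the one out of it merely trade places, so des_B and asc_B are unchanged, whereas inv_D grows by
-- 4·(number of entries before the block) + 1.  Hence σ pairs the terms of 𝔇ₙ² and 𝔇ₙ³ with opposite
-- signs.
module Submission where

open import Defs
open import Level using (Level)
open import Data.Nat as ℕ using (ℕ; _≤_; zero; suc; z≤n; s≤s)
open import Algebra.Bundles using (CommutativeRing; CommutativeMonoid)
open import Data.Bool using (Bool; true; false; _∧_; _∨_; not; if_then_else_)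
open import Data.Bool.Properties using (∧-zeroʳ; ∨-commutativeMonoid)
open import Data.Empty using (⊥; ⊥-elim)
open import Data.Integer as ℤ using (ℤ; +_; -[1+_]; -_; ∣_∣; +<+; -<+; -<-)
import Data.Integer.Properties as ℤ
open import Data.List
  using (List; []; _∷_; _++_; _∷ʳ_; map; length; foldr; concatMap; filterᵇ; applyUpTo; last)
open import Data.List.Properties
  using (filter-++; length-++; last-map; map-++; map-id-local; concatMap-++; applyUpTo-∷ʳ; ++-assoc)
open import Data.List.Membership.Propositional using (_∈_)
open import Data.List.Membership.Propositional.Properties using (∈-++⁺ʳ)
open import Data.List.Relation.Unary.All as All using (All; []; _∷_)
import Data.List.Relation.Unary.All.Properties as All
open import Data.List.Relation.Unary.Any using (here; there)
open import Data.Maybe as Maybe using (just; nothing)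
import Data.Nat.Properties as ℕ
open import Data.Nat.Tactic.RingSolver using (solve-∀)
open import Data.Product using (Σ-syntax; _×_; _,_; proj₁; proj₂)
open import Data.Sum as Sum using (_⊎_; inj₁; inj₂; [_,_]′)
open import Function using (_∘_; id; _⇔_; mk⇔)
open import Function.Definitions using (Injective)
open import Relation.Nullary using (¬_; yes; no)
open import Relation.Nullary.Decidable using (does-⇔; dec-true; dec-false)
open import Relation.Binary.PropositionalEquality
  using (_≡_; _≢_; refl; sym; trans; cong; cong₂; subst; subst₂; module ≡-Reasoning)
open import Algebra.Properties.CommutativeSemigroup
  (CommutativeMonoid.commutativeSemigroup ∨-commutativeMonoid) using (x∙yz≈y∙xz)

private variable
  A B : Set

∧-true : ∀ {a b} → a ∧ b ≡ true → a ≡ true × b ≡ true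
∧-true {true} {true} refl = refl , refl

∨-true : ∀ {a b} → a ∨ b ≡ true → a ≡ true ⊎ b ≡ true
∨-true {true}  _ = inj₁ refl
∨-true {false} e = inj₂ e

==ℕ-refl : ∀ k → (k ==ℕ k) ≡ true
==ℕ-refl k = dec-true (k ℕ.≟ k) refl

==ℕ-false : ∀ {j k} → j ≢ k → (j ==ℕ k) ≡ false
==ℕ-false {j} {k} = dec-false (j ℕ.≟ k)

not-==ℕ : ∀ {j k} → not (j ==ℕ k) ≡ true → j ≢ k
not-==ℕ {j} e refl with () ← trans (sym e) (cong not (==ℕ-refl j))

==ᵇ-refl : ∀ x → (x ==ᵇ x) ≡ true
==ᵇ-refl x = dec-true (x ℤ.≟ x) refl

==ᵇ-map : {f : ℤ → ℤ} → Injective _≡_ _≡_ f → ∀ x y → (f x ==ᵇ f y) ≡ (x ==ᵇ y)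
==ᵇ-map {f} inj x y = does-⇔ (mk⇔ inj (cong f)) (f x ℤ.≟ f y) (x ℤ.≟ y)

==ᵇ⇒≡ : ∀ {x y} → (x ==ᵇ y) ≡ true → x ≡ y
==ᵇ⇒≡ {x} {y} e with x ℤ.≟ y
... | yes x≡y = x≡y

allᵇ⇒All : (p : A → Bool) (xs : List A) → allᵇ p xs ≡ true → All (λ x → p x ≡ true) xs
allᵇ⇒All p []       _ = []
allᵇ⇒All p (x ∷ xs) e = let px , pxs = ∧-true e in px ∷ allᵇ⇒All p xs pxs

allᵇ-map : (p : B → Bool) (q : A → Bool) (f : A → B) → (∀ x → p (f x) ≡ q x) →
           ∀ xs → allᵇ p (map f xs) ≡ allᵇ q xs
allᵇ-map p q f h []       = refl
allᵇ-map p q f h (x ∷ xs) = cong₂ _∧_ (h x) (allᵇ-map p q f h xs)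

countᵇ-∷ : (p : A → Bool) (x : A) (xs : List A) →
           countᵇ p (x ∷ xs) ≡ (if p x then 1 else 0) ℕ.+ countᵇ p xs
countᵇ-∷ p x xs with p x
... | true  = refl
... | false = refl

countᵇ-++ : (p : A → Bool) (xs ys : List A) → countᵇ p (xs ++ ys) ≡ countᵇ p xs ℕ.+ countᵇ p ys
countᵇ-++ p xs ys = trans (cong length (filter-++ _ xs ys)) (length-++ (filterᵇ p xs))

countᵇ-all : (p : A → Bool) {xs : List A} → All (λ x → p x ≡ true) xs → countᵇ p xs ≡ length xs
countᵇ-all p []              = refl
countᵇ-all p {x ∷ xs} (e ∷ es) rewrite countᵇ-∷ p x xs | e = cong suc (countᵇ-all p es)

countᵇ-none : (p : A → Bool) {xs : List A} → All (λ x → p x ≡ false) xs → countᵇ p xs ≡ 0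
countᵇ-none p []                 = refl
countᵇ-none p {x ∷ xs} (e ∷ es) rewrite countᵇ-∷ p x xs | e = countᵇ-none p es

distinctAbs-map : (f : ℤ → ℤ) → (∀ x y → ∣ f x ∣ ≡ ∣ f y ∣ ⇔ ∣ x ∣ ≡ ∣ y ∣) →
                  ∀ w → distinctAbs (map f w) ≡ distinctAbs w
distinctAbs-map f h []      = refl
distinctAbs-map f h (x ∷ w) =
  cong₂ _∧_ (allᵇ-map _ _ f (λ y → cong not (does-⇔ (h x y) (∣ f x ∣ ℕ.≟ ∣ f y ∣) (∣ x ∣ ℕ.≟ ∣ y ∣))) w)
            (distinctAbs-map f h w)

distinctAbs-∈ : ∀ {w x y} → distinctAbs w ≡ true → x ∈ w → y ∈ w → ∣ x ∣ ≡ ∣ y ∣ → x ≡ y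
distinctAbs-∈ d (here refl) (here refl) _ = refl
distinctAbs-∈ {_ ∷ w} d (here refl) (there y∈w) e =
  ⊥-elim (not-==ℕ (All.lookup (allᵇ⇒All _ w (proj₁ (∧-true d))) y∈w) e)
distinctAbs-∈ {_ ∷ w} d (there x∈w) (here refl) e =
  ⊥-elim (not-==ℕ (All.lookup (allᵇ⇒All _ w (proj₁ (∧-true d))) x∈w) (sym e))
distinctAbs-∈ d (there x∈w) (there y∈w) e = distinctAbs-∈ (proj₂ (∧-true d)) x∈w y∈w e

distinctAbs-avoids : ∀ u x y r → distinctAbs (u ++ x ∷ y ∷ r) ≡ true →
                     All (λ z → ∣ x ∣ ≢ ∣ z ∣ × ∣ y ∣ ≢ ∣ z ∣) (u ++ r)
distinctAbs-avoids [] x y r d =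
  let x≁ , d′ = ∧-true d
      y≁ , _  = ∧-true d′
  in All.zipWith (λ (x≁z , y≁z) → not-==ℕ x≁z , not-==ℕ y≁z)
                 (All.tail (allᵇ⇒All _ (y ∷ r) x≁) , allᵇ⇒All _ r y≁)
distinctAbs-avoids (z ∷ u) x y r d with ∧-true d
... | z≁ , d′ with All.++⁻ʳ u (allᵇ⇒All _ (u ++ x ∷ y ∷ r) z≁)
...   | z≁x ∷ z≁y ∷ _ = (not-==ℕ z≁x ∘ sym , not-==ℕ z≁y ∘ sym) ∷ distinctAbs-avoids u x y r d′

adjacent-map : {f : ℤ → ℤ} → Injective _≡_ _≡_ f →
               ∀ a b w → adjacent (f a) (f b) (map f w) ≡ adjacent a b w
adjacent-map inj a b []          = refl
adjacent-map inj a b (x ∷ [])    = refl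
adjacent-map inj a b (x ∷ w@(y ∷ _)) =
  cong₂ _∨_ (cong₂ _∧_ (==ᵇ-map inj x a) (==ᵇ-map inj y b))
            (cong₂ _∨_ (cong₂ _∧_ (==ᵇ-map inj x b) (==ᵇ-map inj y a)) (adjacent-map inj a b w))

adjacent-sym : ∀ a b w → adjacent a b w ≡ adjacent b a w
adjacent-sym a b []          = refl
adjacent-sym a b (x ∷ [])    = refl
adjacent-sym a b (x ∷ w@(y ∷ _)) rewrite adjacent-sym a b w =
  x∙yz≈y∙xz ((x ==ᵇ a) ∧ (y ==ᵇ b)) ((x ==ᵇ b) ∧ (y ==ᵇ a)) (adjacent b a w)

AdjacentSplit : ℤ → ℤ → List ℤ → Set
AdjacentSplit a b w = Σ[ u ∈ List ℤ ] Σ[ r ∈ List ℤ ] (w ≡ u ++ a ∷ b ∷ r ⊎ w ≡ u ++ b ∷ a ∷ r)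

adjacent-split : ∀ a b w → adjacent a b w ≡ true → AdjacentSplit a b w
adjacent-split a b (x ∷ y ∷ w) e =
  [ (λ xy → [] , w , inj₁ (block xy)) ,
    (λ e′ → [ (λ yx → [] , w , inj₂ (block yx)) ,
              (λ e″ → prepend (adjacent-split a b (y ∷ w) e″)) ]′ (∨-true e′)) ]′ (∨-true e)
  where
  block : ∀ {p q} → (x ==ᵇ p) ∧ (y ==ᵇ q) ≡ true → x ∷ y ∷ w ≡ p ∷ q ∷ w
  block xy = let xp , yq = ∧-true xy in cong₂ (λ p q → p ∷ q ∷ w) (==ᵇ⇒≡ xp) (==ᵇ⇒≡ yq)
  prepend : AdjacentSplit a b (y ∷ w) → AdjacentSplit a b (x ∷ y ∷ w)
  prepend (u , r , eq) = x ∷ u , r , Sum.map (cong (x ∷_)) (cong (x ∷_)) eq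

adjacent⇒∈ : ∀ a b w → adjacent a b w ≡ true → a ∈ w
adjacent⇒∈ a b w e with adjacent-split a b w e
... | u , r , inj₁ refl = ∈-++⁺ʳ u (here refl)
... | u , r , inj₂ refl = ∈-++⁺ʳ u (there (here refl))

lastNotIn-just : ∀ F w {z} → last w ≡ just z → lastNotIn F w ≡ allᵇ (λ f → not (z ==ᵇ f)) F
lastNotIn-just F w e with last w | e
... | just _ | refl = refl

lastNotIn-nothing : ∀ F w → last w ≡ nothing → lastNotIn F w ≡ true
lastNotIn-nothing F w e with last w | e
... | nothing | refl = refl

lastNotIn-map : {f : ℤ → ℤ} → Injective _≡_ _≡_ f → ∀ F w → lastNotIn (map f F) (map f w) ≡ lastNotIn F w
lastNotIn-map {f} inj F w with last w in e
... | nothing = lastNotIn-nothing (map f F) (map f w) (trans (last-map f w) (cong (Maybe.map f) e))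
... | just z  = trans (lastNotIn-just (map f F) (map f w) (trans (last-map f w) (cong (Maybe.map f) e)))
                      (allᵇ-map _ _ f (λ g → cong not (==ᵇ-map inj z g)) F)

lastNotIn-swap : ∀ a b w → lastNotIn (a ∷ b ∷ []) w ≡ lastNotIn (b ∷ a ∷ []) w
lastNotIn-swap a b w with last w
... | nothing = refl
... | just z with z ==ᵇ a | z ==ᵇ b
...   | true  | true  = refl
...   | true  | false = refl
...   | false | true  = refl
...   | false | false = refl

last-++-∷ : ∀ (u : List A) x v → last (u ++ x ∷ v) ≡ last (x ∷ v)
last-++-∷ []           x v = refl
last-++-∷ (z ∷ [])     x v = refl
last-++-∷ (z ∷ z′ ∷ u) x v = last-++-∷ (z′ ∷ u) x v

lastNotIn-block : ∀ F u x y → lastNotIn F (u ++ x ∷ y ∷ []) ≡ true → ¬ y ∈ F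
lastNotIn-block F u x y e y∈F with lastNotIn-just F (u ++ x ∷ y ∷ []) (last-++-∷ u x (y ∷ []))
... | eq with () ← trans (sym (All.lookup (allᵇ⇒All _ F (trans (sym eq) e)) y∈F)) (cong not (==ᵇ-refl y))

filterᵇ-map-fixed : (p : A → Bool) (f : A → A) → (∀ x → p (f x) ≡ p x) → (∀ x → p x ≡ true → f x ≡ x) →
                    ∀ xs → filterᵇ p (map f xs) ≡ filterᵇ p xs
filterᵇ-map-fixed p f p∘f fixed [] = refl
filterᵇ-map-fixed p f p∘f fixed (x ∷ xs) rewrite p∘f x with p x in e
... | true  = cong₂ _∷_ (fixed x e) (filterᵇ-map-fixed p f p∘f fixed xs)
... | false = filterᵇ-map-fixed p f p∘f fixed xs

Small : ℕ → ℤ → Set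
Small m z = ∣ z ∣ ℕ.≤ m

Above Below : ℕ → ℤ → Set
Above m x = ∀ z → Small m z → z ℤ.< x
Below m x = ∀ z → Small m z → x ℤ.< z

small-neg : ∀ {m} z → Small m z → Small m (- z)
small-neg z = subst (ℕ._≤ _) (sym (ℤ.∣-i∣≡∣i∣ z))

above-+ : ∀ {m k} → m ℕ.< k → Above m (+ k)
above-+ m<k (+ j)    j≤m = +<+ (ℕ.≤-<-trans j≤m m<k)
above-+ m<k -[1+ j ] _   = -<+

below--[1+] : ∀ {m k} → m ℕ.≤ k → Below m -[1+ k ]
below--[1+] m≤k (+ j)    _   = -<+
below--[1+] m≤k -[1+ j ] j<m = -<- (ℕ.<-≤-trans j<m m≤k)

above-neg : ∀ {m x} → Above m x → Below m (- x)
above-neg {x = x} above z z-small =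
  subst (- x ℤ.<_) (ℤ.neg-involutive z) (ℤ.neg-mono-< (above (- z) (small-neg z z-small)))

below-neg : ∀ {m x} → Below m x → Above m (- x)
below-neg {x = x} below z z-small =
  subst (ℤ._< - x) (ℤ.neg-involutive z) (ℤ.neg-mono-< (below (- z) (small-neg z z-small)))

<⇒<ᵇ : ∀ {x y} → x ℤ.< y → (x <ᵇ y) ≡ true
<⇒<ᵇ {x} {y} = dec-true (x ℤ.<? y)

>⇒<ᵇ : ∀ {x y} → y ℤ.< x → (x <ᵇ y) ≡ false
>⇒<ᵇ {x} {y} y<x = dec-false (x ℤ.<? y) (ℤ.<-asym y<x)

countᵇ-<-above : ∀ {m x r} → Above m x → All (Small m) r → countᵇ (_<ᵇ x) r ≡ length r
countᵇ-<-above above rs = countᵇ-all _ (All.map (λ {z} z-small → <⇒<ᵇ (above z z-small)) rs)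

countᵇ-<-below : ∀ {m x r} → Below m x → All (Small m) r → countᵇ (_<ᵇ x) r ≡ 0
countᵇ-<-below below rs = countᵇ-none _ (All.map (λ {z} z-small → >⇒<ᵇ (below z z-small)) rs)

even-+-2 : ∀ a b → even (a ℕ.+ suc (suc b)) ≡ even (a ℕ.+ b)
even-+-2 a b = cong even (trans (ℕ.+-suc a (suc b)) (cong suc (ℕ.+-suc a b)))

record Flip (m : ℕ) (x y x′ y′ : ℤ) : Set where
  field
    x-above  : Above m x
    y-above  : Above m y
    x′-below : Below m x′
    y′-below : Below m y′
    order    : (y <ᵇ x) ≡ (y′ <ᵇ x′)

module _ {m x y x′ y′} (F : Flip m x y x′ y′) where
  open Flip F

  isD-flip : ∀ u r → isD (u ++ x′ ∷ y′ ∷ r) ≡ isD (u ++ x ∷ y ∷ r)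
  isD-flip u r
    rewrite countᵇ-++ (_<ᵇ + 0) u (x′ ∷ y′ ∷ r) | countᵇ-++ (_<ᵇ + 0) u (x ∷ y ∷ r)
          | countᵇ-∷ (_<ᵇ + 0) x′ (y′ ∷ r) | countᵇ-∷ (_<ᵇ + 0) y′ r
          | countᵇ-∷ (_<ᵇ + 0) x (y ∷ r) | countᵇ-∷ (_<ᵇ + 0) y r
          | <⇒<ᵇ (x′-below (+ 0) z≤n) | <⇒<ᵇ (y′-below (+ 0) z≤n)
          | >⇒<ᵇ (x-above (+ 0) z≤n) | >⇒<ᵇ (y-above (+ 0) z≤n)
    = even-+-2 (negs u) (negs r)

  count-flip : ∀ z r → Small m z →
               countᵇ (_<ᵇ z) (x′ ∷ y′ ∷ r) ≡ suc (suc (countᵇ (_<ᵇ z) (x ∷ y ∷ r)))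
  count-flip z r z-small
    rewrite countᵇ-∷ (_<ᵇ z) x′ (y′ ∷ r) | countᵇ-∷ (_<ᵇ z) y′ r
          | countᵇ-∷ (_<ᵇ z) x (y ∷ r) | countᵇ-∷ (_<ᵇ z) y r
          | <⇒<ᵇ (x′-below z z-small) | <⇒<ᵇ (y′-below z z-small)
          | >⇒<ᵇ (x-above z z-small) | >⇒<ᵇ (y-above z z-small)
    = refl

  invD-flip-block : ∀ r → All (Small m) r → invD (x′ ∷ y′ ∷ r) ≡ suc (invD (x ∷ y ∷ r))
  invD-flip-block r rs
    rewrite countᵇ-∷ (_<ᵇ x′) y′ r | countᵇ-∷ (_<ᵇ - x′) y′ r
          | countᵇ-∷ (_<ᵇ x) y r | countᵇ-∷ (_<ᵇ - x) y r
          | countᵇ-<-below x′-below rs | countᵇ-<-above (below-neg x′-below) rs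
          | countᵇ-<-below y′-below rs | countᵇ-<-above (below-neg y′-below) rs
          | countᵇ-<-above x-above rs | countᵇ-<-below (above-neg x-above) rs
          | countᵇ-<-above y-above rs | countᵇ-<-below (above-neg y-above) rs
          | sym order
          | <⇒<ᵇ (ℤ.<-trans (y′-below (+ 0) z≤n) (below-neg x′-below (+ 0) z≤n))
          | >⇒<ᵇ (ℤ.<-trans (above-neg x-above (+ 0) z≤n) (y-above (+ 0) z≤n))
    = arithmetic (if y <ᵇ x then 1 else 0) (length r) (invD r)
    where
    arithmetic : ∀ o l i → o ℕ.+ 0 ℕ.+ (1 ℕ.+ l) ℕ.+ (0 ℕ.+ l ℕ.+ i)
                         ≡ suc (o ℕ.+ l ℕ.+ (0 ℕ.+ 0) ℕ.+ (l ℕ.+ 0 ℕ.+ i))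
    arithmetic = solve-∀

  -- An entry z in front of the block meets both block entries as z and as −z, and all four
  -- comparisons change.
  invD-flip : ∀ u r → All (Small m) u → All (Small m) r →
              invD (u ++ x′ ∷ y′ ∷ r) ≡ length u ℕ.* 4 ℕ.+ suc (invD (u ++ x ∷ y ∷ r))
  invD-flip []      r []         rs = invD-flip-block r rs
  invD-flip (z ∷ u) r (zs ∷ us) rs
    rewrite countᵇ-++ (_<ᵇ z) u (x′ ∷ y′ ∷ r) | countᵇ-++ (_<ᵇ - z) u (x′ ∷ y′ ∷ r)
          | countᵇ-++ (_<ᵇ z) u (x ∷ y ∷ r) | countᵇ-++ (_<ᵇ - z) u (x ∷ y ∷ r)
          | count-flip z r zs | count-flip (- z) r (small-neg z zs) | invD-flip u r us rs
    = arithmetic (countᵇ (_<ᵇ z) u) (countᵇ (_<ᵇ z) (x ∷ y ∷ r))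
                 (countᵇ (_<ᵇ - z) u) (countᵇ (_<ᵇ - z) (x ∷ y ∷ r))
                 (length u) (invD (u ++ x ∷ y ∷ r))
    where
    arithmetic : ∀ a b c d l i → a ℕ.+ suc (suc b) ℕ.+ (c ℕ.+ suc (suc d)) ℕ.+ (l ℕ.* 4 ℕ.+ suc i)
                               ≡ suc l ℕ.* 4 ℕ.+ suc (a ℕ.+ b ℕ.+ (c ℕ.+ d) ℕ.+ i)
    arithmetic = solve-∀

  descents-flip : ∀ z u c v → Small m z → All (Small m) u → Small m c →
                  descents (z ∷ u ++ x′ ∷ y′ ∷ c ∷ v) ≡ descents (z ∷ u ++ x ∷ y ∷ c ∷ v)
  descents-flip z [] c v zs [] cs
    rewrite <⇒<ᵇ (x′-below z zs) | >⇒<ᵇ (x-above z zs)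
          | <⇒<ᵇ (y-above c cs) | >⇒<ᵇ (y′-below c cs) | order
    = sym (ℕ.+-suc _ _)
  descents-flip z (w ∷ u) c v zs (ws ∷ us) cs =
    cong ((if w <ᵇ z then 1 else 0) ℕ.+_) (descents-flip w u c v ws us cs)

module Involution (m : ℕ) where

  n : ℕ
  n = suc (suc m)

  σ : ℤ → ℤ
  σ (+ k)    = if k ==ℕ n then - (+ suc m) else if k ==ℕ suc m then - (+ n) else + k
  σ -[1+ k ] = if k ==ℕ suc m then + suc m else if k ==ℕ m then + n else -[1+ k ]

  σ-pos-n : σ (+ n) ≡ - (+ suc m)
  σ-pos-n rewrite ==ℕ-refl n = refl

  σ-pos-n-1 : σ (+ suc m) ≡ - (+ n)
  σ-pos-n-1 rewrite ==ℕ-false (ℕ.<⇒≢ (ℕ.n<1+n (suc m))) | ==ℕ-refl (suc m) = refl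

  σ-neg-n : σ (- (+ n)) ≡ + suc m
  σ-neg-n rewrite ==ℕ-refl (suc m) = refl

  σ-neg-n-1 : σ (- (+ suc m)) ≡ + n
  σ-neg-n-1 rewrite ==ℕ-false (ℕ.<⇒≢ (ℕ.n<1+n m)) | ==ℕ-refl m = refl

  σ-fixed : ∀ z → ∣ z ∣ ≢ n → ∣ z ∣ ≢ suc m → σ z ≡ z
  σ-fixed (+ k) k≢n k≢n-1 rewrite ==ℕ-false k≢n | ==ℕ-false k≢n-1 = refl
  σ-fixed -[1+ k ] k≢n k≢n-1
    rewrite ==ℕ-false (k≢n ∘ cong suc) | ==ℕ-false (k≢n-1 ∘ cong suc) = refl

  data Letter : ℤ → Set where
    pos-n   : Letter (+ n)
    neg-n   : Letter (- (+ n))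
    pos-n-1 : Letter (+ suc m)
    neg-n-1 : Letter (- (+ suc m))
    other   : ∀ {z} → ∣ z ∣ ≢ n → ∣ z ∣ ≢ suc m → Letter z

  letter : ∀ z → Letter z
  letter (+ k) with k ℕ.≟ n | k ℕ.≟ suc m
  ... | yes refl | _        = pos-n
  ... | no _     | yes refl = pos-n-1
  ... | no k≢n   | no k≢n-1 = other k≢n k≢n-1
  letter -[1+ k ] with k ℕ.≟ suc m | k ℕ.≟ m
  ... | yes refl | _        = neg-n
  ... | no _     | yes refl = neg-n-1
  ... | no k≢n-1 | no k≢n-2 = other (k≢n-1 ∘ ℕ.suc-injective) (k≢n-2 ∘ ℕ.suc-injective)

  σ-involutive : ∀ z → σ (σ z) ≡ z
  σ-involutive z with letter z
  ... | pos-n           = trans (cong σ σ-pos-n) σ-neg-n-1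
  ... | neg-n           = trans (cong σ σ-neg-n) σ-pos-n-1
  ... | pos-n-1         = trans (cong σ σ-pos-n-1) σ-neg-n
  ... | neg-n-1         = trans (cong σ σ-neg-n-1) σ-pos-n
  ... | other z≢n z≢n-1 = trans (cong σ (σ-fixed z z≢n z≢n-1)) (σ-fixed z z≢n z≢n-1)

  σ-injective : Injective _≡_ _≡_ σ
  σ-injective {x} {y} σx≡σy = trans (sym (σ-involutive x)) (trans (cong σ σx≡σy) (σ-involutive y))

  ∣σ∣-factors-through-∣∣ : ∀ z → ∣ σ z ∣ ≡ ∣ σ (+ ∣ z ∣) ∣
  ∣σ∣-factors-through-∣∣ z with letter z
  ... | pos-n           = refl
  ... | neg-n           = trans (cong ∣_∣ σ-neg-n) (cong ∣_∣ (sym σ-pos-n))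
  ... | pos-n-1         = refl
  ... | neg-n-1         = trans (cong ∣_∣ σ-neg-n-1) (cong ∣_∣ (sym σ-pos-n-1))
  ... | other z≢n z≢n-1 =
    trans (cong ∣_∣ (σ-fixed z z≢n z≢n-1)) (cong ∣_∣ (sym (σ-fixed (+ ∣ z ∣) z≢n z≢n-1)))

  ∣σ∣-cong : ∀ {x y} → ∣ x ∣ ≡ ∣ y ∣ → ∣ σ x ∣ ≡ ∣ σ y ∣
  ∣σ∣-cong {x} {y} e =
    trans (∣σ∣-factors-through-∣∣ x) (trans (cong (∣_∣ ∘ σ ∘ +_) e) (sym (∣σ∣-factors-through-∣∣ y)))

  ∣σ∣-⇔ : ∀ x y → ∣ σ x ∣ ≡ ∣ σ y ∣ ⇔ ∣ x ∣ ≡ ∣ y ∣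
  ∣σ∣-⇔ x y = mk⇔ (subst₂ (λ a b → ∣ a ∣ ≡ ∣ b ∣) (σ-involutive x) (σ-involutive y) ∘ ∣σ∣-cong {σ x} {σ y})
                  (∣σ∣-cong {x} {y})

  keep : ℤ → Bool
  keep x = not (∣ x ∣ ==ℕ n) ∧ not (∣ x ∣ ==ℕ suc m)

  keep-n : ∀ x → ∣ x ∣ ≡ n → keep x ≡ false
  keep-n x e rewrite e | ==ℕ-refl n = refl

  keep-n-1 : ∀ x → ∣ x ∣ ≡ suc m → keep x ≡ false
  keep-n-1 x e rewrite e | ==ℕ-refl (suc m) = ∧-zeroʳ _

  keep-σ : ∀ x → keep (σ x) ≡ keep x
  keep-σ x with letter x
  ... | pos-n   = trans (cong keep σ-pos-n) (trans (keep-n-1 (- (+ suc m)) refl) (sym (keep-n x refl)))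
  ... | neg-n   = trans (cong keep σ-neg-n) (trans (keep-n-1 (+ suc m) refl) (sym (keep-n x refl)))
  ... | pos-n-1 = trans (cong keep σ-pos-n-1) (trans (keep-n (- (+ n)) refl) (sym (keep-n-1 x refl)))
  ... | neg-n-1 = trans (cong keep σ-neg-n-1) (trans (keep-n (+ n) refl) (sym (keep-n-1 x refl)))
  ... | other x≢n x≢n-1 = cong keep (σ-fixed x x≢n x≢n-1)

  kept⇒fixed : ∀ x → keep x ≡ true → σ x ≡ x
  kept⇒fixed x e = let x≢n , x≢n-1 = ∧-true e in σ-fixed x (not-==ℕ x≢n) (not-==ℕ x≢n-1)

  pp-σ : ∀ w → pp n (map σ w) ≡ pp n w
  pp-σ = filterᵇ-map-fixed keep σ keep-σ kept⇒fixed

  adjacent-σ : ∀ w → adjacent (- (+ n)) (- (+ suc m)) (map σ w) ≡ adjacent (+ n) (+ suc m) w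
  adjacent-σ w = begin
    adjacent (- (+ n)) (- (+ suc m)) (map σ w)  ≡⟨ cong₂ (λ a b → adjacent a b (map σ w)) σ-pos-n-1 σ-pos-n ⟨
    adjacent (σ (+ suc m)) (σ (+ n)) (map σ w)  ≡⟨ adjacent-map σ-injective (+ suc m) (+ n) w ⟩
    adjacent (+ suc m) (+ n) w                  ≡⟨ adjacent-sym (+ suc m) (+ n) w ⟩
    adjacent (+ n) (+ suc m) w                  ∎
    where open ≡-Reasoning

  lastNotIn-σ : ∀ w → lastNotIn (- (+ suc m) ∷ - (+ n) ∷ []) (map σ w) ≡ lastNotIn (+ suc m ∷ + n ∷ []) w
  lastNotIn-σ w = begin
    lastNotIn (- (+ suc m) ∷ - (+ n) ∷ []) (map σ w)
      ≡⟨ lastNotIn-swap _ _ (map σ w) ⟩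
    lastNotIn (- (+ n) ∷ - (+ suc m) ∷ []) (map σ w)
      ≡⟨ cong₂ (λ a b → lastNotIn (a ∷ b ∷ []) (map σ w)) σ-pos-n-1 σ-pos-n ⟨
    lastNotIn (map σ (+ suc m ∷ + n ∷ [])) (map σ w)
      ≡⟨ lastNotIn-map σ-injective _ w ⟩
    lastNotIn (+ suc m ∷ + n ∷ []) w
      ∎
    where open ≡-Reasoning

  small-fixed : ∀ z → Small m z → σ z ≡ z
  small-fixed z z≤m = σ-fixed z (ℕ.<⇒≢ (s≤s (ℕ.m≤n⇒m≤1+n z≤m))) (ℕ.<⇒≢ (s≤s z≤m))

  letters-n : letters n ≡ letters m ++ + suc m ∷ - (+ suc m) ∷ + n ∷ - (+ n) ∷ []
  letters-n = trans (cong (concatMap _) upTo-n) (concatMap-++ _ (applyUpTo id m) (m ∷ suc m ∷ []))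
    where
    upTo-n : applyUpTo id n ≡ applyUpTo id m ++ m ∷ suc m ∷ []
    upTo-n = begin
      applyUpTo id n                             ≡⟨ applyUpTo-∷ʳ id (suc m) ⟨
      applyUpTo id (suc m) ∷ʳ suc m              ≡⟨ cong (_∷ʳ suc m) (applyUpTo-∷ʳ id m) ⟨
      (applyUpTo id m ∷ʳ m) ∷ʳ suc m             ≡⟨ ++-assoc (applyUpTo id m) (m ∷ []) (suc m ∷ []) ⟩
      applyUpTo id m ++ m ∷ suc m ∷ []           ∎
      where open ≡-Reasoning

  top-flip : Flip m (+ n) (+ suc m) (- (+ suc m)) (- (+ n))
  top-flip = record
    { x-above  = above-+ (ℕ.m<n⇒m<1+n (ℕ.n<1+n m))
    ; y-above  = above-+ (ℕ.n<1+n m)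
    ; x′-below = below--[1+] ℕ.≤-refl
    ; y′-below = below--[1+] (ℕ.n≤1+n m)
    ; order    = trans (<⇒<ᵇ (+<+ (ℕ.n<1+n (suc m)))) (sym (<⇒<ᵇ (-<- (ℕ.n<1+n m))))
    }

  top-flip′ : Flip m (+ suc m) (+ n) (- (+ n)) (- (+ suc m))
  top-flip′ = record
    { x-above  = Flip.y-above top-flip
    ; y-above  = Flip.x-above top-flip
    ; x′-below = Flip.y′-below top-flip
    ; y′-below = Flip.x′-below top-flip
    ; order    = trans (>⇒<ᵇ (+<+ (ℕ.n<1+n (suc m)))) (sym (>⇒<ᵇ (-<- (ℕ.n<1+n m))))
    }

  Unmoved : ℤ → Set
  Unmoved z = ∣ z ∣ ≢ n × ∣ z ∣ ≢ suc m

  map-σ-block : ∀ u x y r → All Unmoved (u ++ r) → map σ (u ++ x ∷ y ∷ r) ≡ u ++ σ x ∷ σ y ∷ r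
  map-σ-block u x y r unmoved with All.++⁻ u unmoved
  ... | u-unmoved , r-unmoved =
    trans (map-++ σ u (x ∷ y ∷ r))
          (cong₂ (λ a b → a ++ σ x ∷ σ y ∷ b) (map-id-local (All.map fixed u-unmoved))
                                              (map-id-local (All.map fixed r-unmoved)))
    where
    fixed : ∀ {z} → Unmoved z → σ z ≡ z
    fixed {z} (z≢n , z≢n-1) = σ-fixed z z≢n z≢n-1

  record TopBlock (w : List ℤ) : Set where
    field
      u r       : List ℤ
      x y x′ y′ : ℤ
      flip      : Flip m x y x′ y′
      y-top     : y ∈ (+ suc m ∷ + n ∷ [])
      split     : w ≡ u ++ x ∷ y ∷ r
      σ-split   : map σ w ≡ u ++ x′ ∷ y′ ∷ r
      unmoved   : All Unmoved (u ++ r)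

  topBlock : ∀ w → distinctAbs w ≡ true → adjacent (+ n) (+ suc m) w ≡ true → TopBlock w
  topBlock w d a with adjacent-split (+ n) (+ suc m) w a
  ... | u , r , inj₁ refl = record
    { flip = top-flip ; y-top = here refl ; split = refl
    ; σ-split = trans (map-σ-block u _ _ r unmoved) (cong₂ (λ a b → u ++ a ∷ b ∷ r) σ-pos-n σ-pos-n-1)
    ; unmoved = unmoved }
    where
    unmoved = All.map (λ (n≢z , n-1≢z) → n≢z ∘ sym , n-1≢z ∘ sym) (distinctAbs-avoids u _ _ r d)
  ... | u , r , inj₂ refl = record
    { flip = top-flip′ ; y-top = there (here refl) ; split = refl
    ; σ-split = trans (map-σ-block u _ _ r unmoved) (cong₂ (λ a b → u ++ a ∷ b ∷ r) σ-pos-n-1 σ-pos-n)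
    ; unmoved = unmoved }
    where
    unmoved = All.map (λ (n-1≢z , n≢z) → n≢z ∘ sym , n-1≢z ∘ sym) (distinctAbs-avoids u _ _ r d)

  unmoved-small : ∀ z → Small n z → Unmoved z → Small m z
  unmoved-small z ∣z∣≤n (z≢n , z≢n-1) = ℕ.≤-pred (ℕ.≤∧≢⇒< (ℕ.≤-pred (ℕ.≤∧≢⇒< ∣z∣≤n z≢n)) z≢n-1)

  topBlock-small : ∀ {w} (B : TopBlock w) → All (Small n) w →
                   All (Small m) (TopBlock.u B) × All (Small m) (TopBlock.r B)
  topBlock-small B w-small with All.++⁻ u (subst (All (Small n)) split w-small) | All.++⁻ u unmoved
    where open TopBlock B
  ... | u-small , _ ∷ _ ∷ r-small | u-unmoved , r-unmoved =
    All.zipWith (λ {z} (s , um) → unmoved-small z s um) (u-small , u-unmoved) ,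
    All.zipWith (λ {z} (s , um) → unmoved-small z s um) (r-small , r-unmoved)

  isD-σ : ∀ w → distinctAbs w ≡ true → adjacent (+ n) (+ suc m) w ≡ true → isD (map σ w) ≡ isD w
  isD-σ w d a = trans (cong isD σ-split) (trans (isD-flip flip u r) (cong isD (sym split)))
    where open TopBlock (topBlock w d a)

  In𝔇² In𝔇³ : List ℤ → Bool
  In𝔇² w = distinctAbs w ∧ inD2 n w
  In𝔇³ w = distinctAbs w ∧ inD3 n w

  In𝔇³-σ : ∀ w → In𝔇³ (map σ w) ≡ In𝔇² w
  In𝔇³-σ w
    rewrite distinctAbs-map σ ∣σ∣-⇔ w | pp-σ w | adjacent-σ w | lastNotIn-σ w
    with distinctAbs w in d | adjacent (+ n) (+ suc m) w in a
  ... | false | _     = refl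
  ... | true  | true  rewrite isD-σ w d a = refl
  ... | true  | false rewrite ∧-zeroʳ (isD (pp n w)) = trans (∧-zeroʳ _) (sym (∧-zeroʳ _))

  inD⇒adjacent×lastNotIn : ∀ w {a l} → isD w ∧ (isD (pp n w) ∧ (a ∧ l)) ≡ true → a ≡ true × l ≡ true
  inD⇒adjacent×lastNotIn w e = ∧-true (proj₂ (∧-true {isD (pp n w)} (proj₂ (∧-true {isD w} e))))

  In𝔇²-In𝔇³-disjoint : ∀ w → distinctAbs w ≡ true → inD2 n w ≡ true → inD3 n w ≡ true → ⊥
  In𝔇²-In𝔇³-disjoint w d in2 in3 with () ←
    distinctAbs-∈ d (adjacent⇒∈ _ _ w (proj₁ (inD⇒adjacent×lastNotIn w in2)))
                    (adjacent⇒∈ _ _ w (proj₁ (inD⇒adjacent×lastNotIn w in3))) refl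

letters-small : ∀ k → All (Small k) (letters k)
letters-small k = All.concat⁺ (All.map⁺ (All.applyUpTo⁺₁ _ k (λ i<k → i<k ∷ i<k ∷ [])))

words-small : ∀ k j → All (All (Small k)) (words k j)
words-small k zero    = [] ∷ []
words-small k (suc j) =
  All.concat⁺ (All.map⁺ (All.map (λ x-small → All.map⁺ (All.map (x-small ∷_) (words-small k j)))
                                 (letters-small k)))

module Sums {c ℓ : Level} (R : CommutativeRing c ℓ) where
  open CommutativeRing R renaming (-_ to neg; refl to ≈-refl; sym to ≈-sym; trans to ≈-trans)
  open import Relation.Binary.Reasoning.Setoid setoid
  open import Algebra.Properties.Ring ring using (-0#≈0#; -‿+-comm)
  open import Algebra.Properties.CommutativeSemigroup +-commutativeSemigroup using (interchange)

  ∑ : List A → (A → Carrier) → Carrier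
  ∑ xs f = foldr (λ x acc → f x + acc) 0# xs

  ∑-cong : ∀ xs {f g : A → Carrier} → All (λ x → f x ≈ g x) xs → ∑ xs f ≈ ∑ xs g
  ∑-cong []       []         = ≈-refl
  ∑-cong (x ∷ xs) (fx≈gx ∷ h) = +-cong fx≈gx (∑-cong xs h)

  ∑-congᵘ : ∀ xs {f g : A → Carrier} → (∀ x → f x ≈ g x) → ∑ xs f ≈ ∑ xs g
  ∑-congᵘ xs f≈g = ∑-cong xs (All.universal f≈g xs)

  ∑-++ : ∀ xs ys (f : A → Carrier) → ∑ (xs ++ ys) f ≈ ∑ xs f + ∑ ys f
  ∑-++ []       ys f = ≈-sym (+-identityˡ _)
  ∑-++ (x ∷ xs) ys f = ≈-trans (+-congˡ (∑-++ xs ys f)) (≈-sym (+-assoc _ _ _))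

  ∑-concatMap : ∀ (g : A → List B) xs (f : B → Carrier) → ∑ (concatMap g xs) f ≈ ∑ xs (λ x → ∑ (g x) f)
  ∑-concatMap g []       f = ≈-refl
  ∑-concatMap g (x ∷ xs) f = ≈-trans (∑-++ (g x) (concatMap g xs) f) (+-congˡ (∑-concatMap g xs f))

  ∑-map : ∀ (g : A → B) xs (f : B → Carrier) → ∑ (map g xs) f ≈ ∑ xs (f ∘ g)
  ∑-map g []       f = ≈-refl
  ∑-map g (x ∷ xs) f = +-congˡ (∑-map g xs f)

  ∑-filterᵇ : ∀ (p : A → Bool) xs (f : A → Carrier) →
              ∑ (filterᵇ p xs) f ≈ ∑ xs (λ x → if p x then f x else 0#)
  ∑-filterᵇ p []       f = ≈-refl
  ∑-filterᵇ p (x ∷ xs) f with p x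
  ... | true  = +-congˡ (∑-filterᵇ p xs f)
  ... | false = ≈-trans (∑-filterᵇ p xs f) (≈-sym (+-identityˡ _))

  ∑-+ : ∀ xs (f g : A → Carrier) → ∑ xs (λ x → f x + g x) ≈ ∑ xs f + ∑ xs g
  ∑-+ []       f g = ≈-sym (+-identityˡ _)
  ∑-+ (x ∷ xs) f g = ≈-trans (+-congˡ (∑-+ xs f g)) (interchange _ _ _ _)

  ∑-neg : ∀ xs (f : A → Carrier) → ∑ xs (neg ∘ f) ≈ neg (∑ xs f)
  ∑-neg []       f = ≈-sym -0#≈0#
  ∑-neg (x ∷ xs) f = ≈-trans (+-congˡ (∑-neg xs f)) (-‿+-comm _ _)

  ∑-words-map : ∀ (f : ℤ → ℤ) k → (∀ h → ∑ (letters k) h ≈ ∑ (letters k) (h ∘ f)) →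
                ∀ j g → ∑ (words k j) g ≈ ∑ (words k j) (g ∘ map f)
  ∑-words-map f k letters-invariant zero    g = ≈-refl
  ∑-words-map f k letters-invariant (suc j) g = begin
    ∑ (words k (suc j)) g
      ≈⟨ ∑-concatMap extend (letters k) g ⟩
    ∑ (letters k) (λ x → ∑ (extend x) g)
      ≈⟨ ∑-congᵘ (letters k) (λ x → ∑-map (x ∷_) W g) ⟩
    ∑ (letters k) (λ x → ∑ W (λ w → g (x ∷ w)))
      ≈⟨ ∑-congᵘ (letters k) (λ x → ∑-words-map f k letters-invariant j (λ w → g (x ∷ w))) ⟩
    ∑ (letters k) (λ x → ∑ W (λ w → g (x ∷ map f w)))
      ≈⟨ letters-invariant (λ x → ∑ W (λ w → g (x ∷ map f w))) ⟩
    ∑ (letters k) (λ x → ∑ W (λ w → g (f x ∷ map f w)))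
      ≈⟨ ∑-congᵘ (letters k) (λ x → ∑-map (x ∷_) W (g ∘ map f)) ⟨
    ∑ (letters k) (λ x → ∑ (extend x) (g ∘ map f))
      ≈⟨ ∑-concatMap extend (letters k) (g ∘ map f) ⟨
    ∑ (words k (suc j)) (g ∘ map f)
      ∎
    where
    W = words k j
    extend : ℤ → List (List ℤ)
    extend x = map (x ∷_) W

module Cancellation {c ℓ : Level} (R : CommutativeRing c ℓ) (m : ℕ) (s t : CommutativeRing.Carrier R) where
  open CommutativeRing R renaming (-_ to neg; refl to ≈-refl; sym to ≈-sym; trans to ≈-trans)
  open import Relation.Binary.Reasoning.Setoid setoid
  open import Algebra.Properties.Ring ring using (-1*x≈-x; -‿involutive; -‿distribˡ-*; -0#≈0#)
  open import Algebra.Solver.CommutativeMonoid +-commutativeMonoid using (prove; var; _⊕_) renaming (id to ε)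
  open import Data.Fin using () renaming (zero to #0; suc to 1+)
  open import Data.Vec using ([]; _∷_)
  open Involution m
  open Sums R

  weight : List ℤ → Carrier
  weight π = (pow R (neg 1#) (invD π) * pow R s (ascB n π)) * pow R t (desB π)

  -1*-1*x≈x : ∀ x → neg 1# * (neg 1# * x) ≈ x
  -1*-1*x≈x x = ≈-trans (*-congˡ (-1*x≈-x x)) (≈-trans (-1*x≈-x (neg x)) (-‿involutive x))

  pow-neg1-odd : ∀ k i → pow R (neg 1#) (k ℕ.* 4 ℕ.+ suc i) ≈ neg (pow R (neg 1#) i)
  pow-neg1-odd zero    i = -1*x≈-x _
  pow-neg1-odd (suc k) i = ≈-trans (-1*-1*x≈x _) (≈-trans (-1*-1*x≈x _) (pow-neg1-odd k i))

  weight-flip : ∀ w w′ k → invD w′ ≡ k ℕ.* 4 ℕ.+ suc (invD w) → desB w′ ≡ desB w →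
                weight w′ ≈ neg (weight w)
  weight-flip w w′ k inv des = begin
    weight w′
      ≡⟨ cong₂ (λ i d → (pow R (neg 1#) i * pow R s (n ℕ.∸ d)) * pow R t d) inv des ⟩
    (pow R (neg 1#) (k ℕ.* 4 ℕ.+ suc (invD w)) * pow R s (ascB n w)) * pow R t (desB w)
      ≈⟨ *-congʳ (*-congʳ (pow-neg1-odd k (invD w))) ⟩
    (neg (pow R (neg 1#) (invD w)) * pow R s (ascB n w)) * pow R t (desB w)
      ≈⟨ *-congʳ (-‿distribˡ-* _ _) ⟨
    neg (pow R (neg 1#) (invD w) * pow R s (ascB n w)) * pow R t (desB w)
      ≈⟨ -‿distribˡ-* _ _ ⟨
    neg (weight w)
      ∎

  weight-σ : ∀ w → All (Small n) w → In𝔇² w ≡ true → weight (map σ w) ≈ neg (weight w)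
  weight-σ w w-small in2 with ∧-true in2
  ... | d , in2′ with inD⇒adjacent×lastNotIn w in2′
  ... | a , last-ok = begin
    weight (map σ w)               ≡⟨ cong weight σ-split ⟩
    weight (u ++ x′ ∷ y′ ∷ r)      ≈⟨ flip-weight r r-small (subst (λ v → lastNotIn _ v ≡ true) split last-ok) ⟩
    neg (weight (u ++ x ∷ y ∷ r))  ≡⟨ cong (neg ∘ weight) split ⟨
    neg (weight w)                 ∎
    where
    T = topBlock w d a
    open TopBlock T
    u-small = proj₁ (topBlock-small T w-small)
    r-small = proj₂ (topBlock-small T w-small)
    flip-weight : ∀ r → All (Small m) r → lastNotIn (+ suc m ∷ + n ∷ []) (u ++ x ∷ y ∷ r) ≡ true →
                  weight (u ++ x′ ∷ y′ ∷ r) ≈ neg (weight (u ++ x ∷ y ∷ r))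
    flip-weight []      _                          ok = ⊥-elim (lastNotIn-block _ u x y ok y-top)
    flip-weight (c ∷ v) cv-small@(c-small ∷ _) _ =
      weight-flip (u ++ x ∷ y ∷ c ∷ v) (u ++ x′ ∷ y′ ∷ c ∷ v) (length u)
                  (invD-flip flip u (c ∷ v) u-small cv-small)
                  (descents-flip flip (+ 0) u c v z≤n u-small c-small)

  ∑-letters-σ : ∀ h → ∑ (letters n) h ≈ ∑ (letters n) (h ∘ σ)
  ∑-letters-σ h = begin
    ∑ (letters n) h                          ≡⟨ cong (λ l → ∑ l h) letters-n ⟩
    ∑ (letters m ++ top) h                   ≈⟨ ∑-++ (letters m) top h ⟩
    ∑ (letters m) h + ∑ top h                ≈⟨ +-cong (∑-cong _ (All.map fixed (letters-small m))) reversed ⟩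
    ∑ (letters m) (h ∘ σ) + ∑ top (h ∘ σ)    ≈⟨ ∑-++ (letters m) top (h ∘ σ) ⟨
    ∑ (letters m ++ top) (h ∘ σ)             ≡⟨ cong (λ l → ∑ l (h ∘ σ)) letters-n ⟨
    ∑ (letters n) (h ∘ σ)                    ∎
    where
    top : List ℤ
    top = + suc m ∷ - (+ suc m) ∷ + n ∷ - (+ n) ∷ []
    fixed : ∀ {z} → Small m z → h z ≈ h (σ z)
    fixed {z} z-small = reflexive (cong h (sym (small-fixed z z-small)))
    reversed : ∑ top h ≈ ∑ top (h ∘ σ)
    reversed = begin
      h (+ suc m) + (h (- (+ suc m)) + (h (+ n) + (h (- (+ n)) + 0#)))
        ≈⟨ prove 4 (x₁ ⊕ (x₂ ⊕ (x₃ ⊕ (x₄ ⊕ ε)))) (x₄ ⊕ (x₃ ⊕ (x₂ ⊕ (x₁ ⊕ ε))))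
                 (h (+ suc m) ∷ h (- (+ suc m)) ∷ h (+ n) ∷ h (- (+ n)) ∷ []) ⟩
      h (- (+ n)) + (h (+ n) + (h (- (+ suc m)) + (h (+ suc m) + 0#)))
        ≡⟨ cong₂ _+_ (cong h σ-pos-n-1) (cong₂ _+_ (cong h σ-neg-n-1)
             (cong₂ _+_ (cong h σ-pos-n) (cong₂ _+_ (cong h σ-neg-n) refl))) ⟨
      ∑ top (h ∘ σ)
        ∎
      where
      x₁ = var #0
      x₂ = var (1+ #0)
      x₃ = var (1+ (1+ #0))
      x₄ = var (1+ (1+ (1+ #0)))

  weight² weight³ : List ℤ → Carrier
  weight² w = if In𝔇² w then weight w else 0#
  weight³ w = if In𝔇³ w then weight w else 0#

  indicator-split : ∀ w → (if distinctAbs w then (if inD2 n w ∨ inD3 n w then weight w else 0#) else 0#)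
                          ≈ weight² w + weight³ w
  indicator-split w with distinctAbs w in d | inD2 n w in in2 | inD3 n w in in3
  ... | false | _     | _     = ≈-sym (+-identityʳ 0#)
  ... | true  | true  | true  = ⊥-elim (In𝔇²-In𝔇³-disjoint w d in2 in3)
  ... | true  | true  | false = ≈-sym (+-identityʳ _)
  ... | true  | false | true  = ≈-sym (+-identityˡ _)
  ... | true  | false | false = ≈-sym (+-identityʳ 0#)

  weight³-σ : ∀ w → All (Small n) w → weight³ (map σ w) ≈ neg (weight² w)
  weight³-σ w w-small rewrite In𝔇³-σ w with In𝔇² w in in2
  ... | true  = weight-σ w w-small in2
  ... | false = ≈-sym -0#≈0#

  D23sum≈0 : D23sum R n s t ≈ 0#
  D23sum≈0 = begin
    D23sum R n s t                          ≡⟨⟩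
    ∑ (D23 n) weight                        ≈⟨ ∑-filterᵇ _ (filterᵇ distinctAbs W) weight ⟩
    ∑ (filterᵇ distinctAbs W) _             ≈⟨ ∑-filterᵇ distinctAbs W _ ⟩
    ∑ W _                                   ≈⟨ ∑-congᵘ W indicator-split ⟩
    ∑ W (λ w → weight² w + weight³ w)       ≈⟨ ∑-+ W weight² weight³ ⟩
    ∑ W weight² + ∑ W weight³               ≈⟨ +-congˡ (∑-words-map σ n ∑-letters-σ n weight³) ⟩
    ∑ W weight² + ∑ W (weight³ ∘ map σ)     ≈⟨ +-congˡ (∑-cong W (All.map (weight³-σ _) (words-small n n))) ⟩
    ∑ W weight² + ∑ W (neg ∘ weight²)       ≈⟨ +-congˡ (∑-neg W weight²) ⟩
    ∑ W weight² - ∑ W weight²               ≈⟨ -‿inverseʳ _ ⟩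
    0#                                      ∎
    where
    W = words n n

lemma5p6 : {c ℓ : Level} (R : CommutativeRing c ℓ) (n : ℕ) → 3 ≤ n →
    (s t : CommutativeRing.Carrier R) →
    CommutativeRing._≈_ R (D23sum R n s t) (CommutativeRing.0# R)
lemma5p6 R (suc (suc m)) (s≤s (s≤s _)) s t = Cancellation.D23sum≈0 R m s t
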